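{- For every positive integer $n$ there exist infinitely many positive integers $m$ such that, for each of them, there is a finite set $\mathcal{A}$ of $m$ pairs $(a,a_0)$ with $a \in \mathbb{Z}^n \setminus \{0\}$ and $a_0 \in \mathbb{Z}$, for which every $x \in \mathbb{Z}^n$ satisfying $a^\top x \neq a_0$ for all $(a,a_0) \in \mathcal{A}$ has $\|x\|_1 \geq (m+n)/2$.
   Context: A "system" here means the integer system $a^\top x \neq a_0$ for all $(a,a_0)\in\mathcal{A}$, $x \in \mathbb{Z}^n$, where $m = |\mathcal{A}|$ is the number of constraints; a solution is any $x\in\mathbb{Z}^n$ satisfying all constraints. -}

module Defs where

open import Data.Nat using (ℕ)
open import Data.Fin using (Fin)
open import Data.Integer using (ℤ; ∣_∣; +_) renaming (_*_ to _*ℤ_; _+_ to _+ℤ_)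
open import Data.Product using (_×_; ∃; _,_)
open import Data.Vec using (Vec; lookup; foldr′; zipWith; map)
open import Relation.Binary.PropositionalEquality using (_≡_)
open import Relation.Nullary using (¬_)
import Data.Nat as ℕ

-- integer vectors in ℤ^n (inductive vectors, so ≡ is componentwise equality)
ℤVec : ℕ → Set
ℤVec n = Vec ℤ n

dot : ∀ {n} → ℤVec n → ℤVec n → ℤ
dot a x = foldr′ _+ℤ_ (+ 0) (zipWith _*ℤ_ a x)

norm1 : ∀ {n} → ℤVec n → ℕ
norm1 x = foldr′ ℕ._+_ 0 (map ∣_∣ x)

NonZeroVec : ∀ {n} → ℤVec n → Set
NonZeroVec a = ∃ λ i → ¬ (lookup a i ≡ + 0)

Satisfies : ∀ {n} → ℤVec n × ℤ → ℤVec n → Set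
Satisfies (a , a₀) x = ¬ (dot a x ≡ a₀)

IsSolution : ∀ {n m} → (Fin m → ℤVec n × ℤ) → ℤVec n → Set
IsSolution A x = ∀ j → Satisfies (A j) x

-- Forbid, in every coordinate, each of the 2t + 1 values -t, …, t: these are n(2t + 1) constraints
-- of the form eᵢᵀx ≠ c, and every solution has |xᵢ| ≥ t + 1 for all i, hence
-- 2‖x‖₁ ≥ 2n(t + 1) = m + n.  Letting t grow gives infinitely many m.
module Submission where

open import Defs
open import Data.Nat using (ℕ; _≤_; _<_; _+_; _*_)
open import Data.Fin using (Fin)
open import Data.Integer using (ℤ)
open import Data.Product using (_×_; ∃; _,_; proj₁)
open import Function.Definitions using (Injective)
open import Relation.Binary.PropositionalEquality using (_≡_)

open import Data.Nat using (suc; _∸_; s≤s; z≤n)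
open import Data.Nat.Properties
  using (≤-trans; ≤-reflexive; ≰⇒>; m≤m+n; m≤n+m; m∸n≤m; +-mono-≤; +-monoʳ-≤; *-monoʳ-≤;
         m+n∸n≡m; m+n∸m≡n; m∸[m∸n]≡n; ∸-monoʳ-<)
open import Data.Nat.Tactic.RingSolver using (solve-∀)
open import Data.Fin using (toℕ; fromℕ<; remQuot; combine) renaming (zero to fzero; suc to fsuc)
open import Data.Fin.Properties using (toℕ-fromℕ<; toℕ-injective; combine-remQuot; remQuot-combine)
open import Data.Integer using (+_; -[1+_]; -_; _⊖_; ∣_∣) renaming (_+_ to _+ℤ_; _*_ to _*ℤ_)
open import Data.Integer.Properties
  using (+-identityˡ; +-identityʳ; *-identityˡ; +-injective; distribˡ-⊖-+-pos; ⊖-≥; ⊖-<)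
open import Data.Product using (proj₂; uncurry)
open import Data.Vec using ([]; _∷_; replicate; lookup; tail)
open import Function using (_∘_)
open import Relation.Binary.PropositionalEquality using (refl; sym; trans; cong; cong₂; module ≡-Reasoning)
open import Relation.Nullary using (¬_)

open ≡-Reasoning

unit : ∀ {n} → Fin n → ℤVec n
unit {suc n} fzero    = + 1 ∷ replicate n (+ 0)
unit {suc n} (fsuc i) = + 0 ∷ unit i

dot-zeroˡ : ∀ {n} (x : ℤVec n) → dot (replicate n (+ 0)) x ≡ + 0
dot-zeroˡ []       = refl
dot-zeroˡ (_ ∷ xs) = cong (+ 0 +ℤ_) (dot-zeroˡ xs)

dot-unit : ∀ {n} (i : Fin n) (x : ℤVec n) → dot (unit i) x ≡ lookup x i
dot-unit fzero (x ∷ xs) = begin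
  + 1 *ℤ x +ℤ dot (replicate _ (+ 0)) xs ≡⟨ cong₂ _+ℤ_ (*-identityˡ x) (dot-zeroˡ xs) ⟩
  x +ℤ + 0                              ≡⟨ +-identityʳ x ⟩
  x                                     ∎
dot-unit (fsuc i) (x ∷ xs) = trans (+-identityˡ _) (dot-unit i xs)

unit-injective : ∀ {n} → Injective _≡_ _≡_ (unit {n})
unit-injective {_} {fzero}  {fzero}  _  = refl
unit-injective {_} {fsuc i} {fsuc j} eq = cong fsuc (unit-injective (cong tail eq))

unit-nonZero : ∀ {n} (i : Fin n) → NonZeroVec (unit i)
unit-nonZero i = i , λ eq → 1≢0 (trans (sym (lookup-unit i)) eq)
  where
  lookup-unit : ∀ {n} (i : Fin n) → lookup (unit i) i ≡ + 1
  lookup-unit fzero    = refl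
  lookup-unit (fsuc i) = lookup-unit i

  1≢0 : ¬ (+ 1 ≡ + 0)
  1≢0 ()

norm1-lowerBound : ∀ {n} c (x : ℤVec n) → (∀ i → c ≤ ∣ lookup x i ∣) → n * c ≤ norm1 x
norm1-lowerBound c []       _ = z≤n
norm1-lowerBound c (x ∷ xs) h = +-mono-≤ (h fzero) (norm1-lowerBound c xs (h ∘ fsuc))

remQuot-injective : ∀ {n} k → Injective _≡_ _≡_ (remQuot {n} k)
remQuot-injective {n} k {i} {j} eq =
  trans (sym (combine-remQuot {n} k i)) (trans (cong (uncurry combine) eq) (combine-remQuot {n} k j))

coordinateSystem : ∀ n {k} → (Fin k → ℤ) → Fin (n * k) → ℤVec n × ℤ
coordinateSystem n {k} w = uncurry (λ i r → unit i , w r) ∘ remQuot {n} k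

coordinateSystem-injective : ∀ n {k} {w : Fin k → ℤ} → Injective _≡_ _≡_ w →
                             Injective _≡_ _≡_ (coordinateSystem n w)
coordinateSystem-injective n {k} w-inj eq = remQuot-injective {n} k
  (cong₂ _,_ (unit-injective (cong proj₁ eq)) (w-inj (cong proj₂ eq)))

coordinateSystem-nonZero : ∀ n {k} (w : Fin k → ℤ) j → NonZeroVec (proj₁ (coordinateSystem n w j))
coordinateSystem-nonZero n {k} w j = unit-nonZero (proj₁ (remQuot {n} k j))

coordinateSystem-avoids : ∀ n {k} (w : Fin k → ℤ) (x : ℤVec n) → IsSolution (coordinateSystem n w) x →
                          ∀ i r → ¬ (lookup x i ≡ w r)
coordinateSystem-avoids n {k} w x sol i r eq = sol (combine i r) (begin
  dot (proj₁ (coordinateSystem n w (combine i r))) x ≡⟨ cong (λ p → dot (unit (proj₁ p)) x) (remQuot-combine i r) ⟩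
  dot (unit i) x                                     ≡⟨ dot-unit i x ⟩
  lookup x i                                         ≡⟨ eq ⟩
  w r                                                ≡⟨ cong (w ∘ proj₂) (remQuot-combine i r) ⟨
  proj₂ (coordinateSystem n w (combine i r))         ∎)

window : ∀ t → Fin (suc (t + t)) → ℤ
window t r = toℕ r ⊖ t

⊖-+-cancel : ∀ a t → (a ⊖ t) +ℤ + t ≡ + a
⊖-+-cancel a t = begin
  (a ⊖ t) +ℤ + t ≡⟨ distribˡ-⊖-+-pos t a t ⟩
  (a + t) ⊖ t    ≡⟨ ⊖-≥ (m≤n+m t a) ⟩
  + (a + t ∸ t)  ≡⟨ cong +_ (m+n∸n≡m a t) ⟩
  + a            ∎

window-injective : ∀ t → Injective _≡_ _≡_ (window t)
window-injective t {r} {s} eq = toℕ-injective (+-injective (begin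
  + toℕ r                 ≡⟨ sym (⊖-+-cancel (toℕ r) t) ⟩
  window t r +ℤ + t       ≡⟨ cong (_+ℤ + t) eq ⟩
  window t s +ℤ + t       ≡⟨ ⊖-+-cancel (toℕ s) t ⟩
  + toℕ s                 ∎))

window-hits : ∀ t {a z} → a ≤ t + t → a ⊖ t ≡ z → ∃ λ r → window t r ≡ z
window-hits t a≤ eq = fromℕ< (s≤s a≤) , trans (cong (_⊖ t) (toℕ-fromℕ< (s≤s a≤))) eq

window-complete : ∀ t z → ∣ z ∣ ≤ t → ∃ λ r → window t r ≡ z
window-complete t (+ k) k≤t = window-hits t (+-monoʳ-≤ t k≤t) (begin
  (t + k) ⊖ t   ≡⟨ ⊖-≥ (m≤m+n t k) ⟩
  + (t + k ∸ t) ≡⟨ cong +_ (m+n∸m≡n t k) ⟩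
  + k           ∎)
window-complete t -[1+ k ] k<t = window-hits t (≤-trans (m∸n≤m t (suc k)) (m≤m+n t t)) (begin
  (t ∸ suc k) ⊖ t         ≡⟨ ⊖-< (∸-monoʳ-< {t} {suc k} {0} (s≤s z≤n) k<t) ⟩
  - + (t ∸ (t ∸ suc k))   ≡⟨ cong (-_ ∘ +_) (m∸[m∸n]≡n k<t) ⟩
  -[1+ k ]                ∎)

outside-window : ∀ t z → (∀ r → ¬ (z ≡ window t r)) → t < ∣ z ∣
outside-window t z avoid = ≰⇒> λ ∣z∣≤t →
  let r , eq = window-complete t z ∣z∣≤t in avoid r (sym eq)

n*[2t+1]+n≡2*[n*[t+1]] : ∀ n t → n * suc (t + t) + n ≡ 2 * (n * suc t)
n*[2t+1]+n≡2*[n*[t+1]] = solve-∀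

proposition2 : ∀ (n : ℕ) → 1 ≤ n → ∀ (N : ℕ) → ∃ λ (m : ℕ) → N < m × 1 ≤ m ×
    ∃ λ (A : Fin m → ℤVec n × ℤ) → Injective _≡_ _≡_ A ×
    (∀ j → NonZeroVec (proj₁ (A j))) ×
    (∀ (x : ℤVec n) → IsSolution A x → m + n ≤ 2 * norm1 x)
proposition2 (suc n) _ N =
  suc n * k , N<m , s≤s z≤n ,
  A , coordinateSystem-injective (suc n) (window-injective N) ,
  coordinateSystem-nonZero (suc n) (window N) , norm1-bound
  where
  k = suc (N + N)
  A = coordinateSystem (suc n) (window N)

  N<m : N < suc n * k
  N<m = ≤-trans (s≤s (m≤m+n N N)) (m≤m+n k (n * k))

  norm1-bound : ∀ x → IsSolution A x → suc n * k + suc n ≤ 2 * norm1 x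
  norm1-bound x sol = ≤-trans (≤-reflexive (n*[2t+1]+n≡2*[n*[t+1]] (suc n) N))
    (*-monoʳ-≤ 2 (norm1-lowerBound (suc N) x coordinate-large))
    where
    coordinate-large : ∀ i → suc N ≤ ∣ lookup x i ∣
    coordinate-large i = outside-window N (lookup x i) (coordinateSystem-avoids (suc n) (window N) x sol i)
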